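{- There is a function $\varepsilon:\mathbb{Z}_{\ge 1}\to\mathbb{R}_{\ge 0}$ with $\varepsilon(n)\to 0$ as $n\to\infty$ such that the following holds. Let $G$ be a finite cyclic group of order $n$ with generator $\gamma$, let $D:G\times G\to G$ be the bivariate Diffie-Hellman mapping $D(\gamma^a,\gamma^b)=\gamma^{ab}$, $a,b=0,\ldots,n-1$, and let $f:G\times G\to G$ be any mapping having $(\ell_1,\ell_2)$ as an index pair. Then the number of pairs $(x,y)\in G\times G$ with $f(x,y)=D(x,y)$ is at most $\ell_1\ell_2\, n^{1+\varepsilon(n)}$.
   Context: For a positive divisor $\ell$ of $n$, let $C_{\ell,0}=\{\gamma^{j\ell}: j=0,1,\ldots,n/\ell-1\}$ and $C_{\ell,i}=\gamma^i C_{\ell,0}$ for $i=0,1,\ldots,\ell-1$. For positive divisors $\ell_1,\ell_2$ of $n$, a pair $(\ell_1,\ell_2)$ is called an index pair of a mapping $f:G\times G\to G$ if there exist positive integers $r_1,r_2$ and elements $a_{k_1,k_2}\in G$ ($0\le k_1\le \ell_1-1$, $0\le k_2\le \ell_2-1$) such that $f(x,y)=a_{k_1,k_2}x^{r_1}y^{r_2}$ whenever $(x,y)\in C_{\ell_1,k_1}\times C_{\ell_2,k_2}$. -}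

module Defs where

open import Data.Nat using (ℕ; _+_; _*_; _≤_; NonZero)
open import Data.Nat.DivMod using (_mod_)
open import Data.Fin using (Fin; toℕ)
import Data.Fin as F
open import Data.List using (List; length; filter; allFin; cartesianProduct)
open import Data.Product using (Σ; _×_; _,_; ∃; ∃-syntax)
open import Relation.Binary.PropositionalEquality using (_≡_)

-- The cyclic group G = ⟨γ⟩ of order n is represented by exponents:
-- the element γ^a (0 ≤ a ≤ n-1) is represented by a : Fin n.
-- Multiplication γ^a γ^b = γ^((a+b) mod n), powers (γ^a)^r = γ^(r a mod n).

Map : ℕ → Set
Map n = Fin n → Fin n → Fin n

DH : (n : ℕ) .{{_ : NonZero n}} → Map n
DH n a b = (toℕ a * toℕ b) mod n

-- (ℓ₁, ℓ₂) is an index pair of f.  For ℓ ∣ n, γ^a ∈ C_{ℓ,k} iff a mod ℓ = k.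
-- The coefficient a_{k₁,k₂} = γ^(c k₁ k₂); f(x,y) = a_{k₁,k₂} x^{r₁} y^{r₂}.
IsIndexPair : (n ℓ₁ ℓ₂ : ℕ) .{{_ : NonZero n}} .{{_ : NonZero ℓ₁}} .{{_ : NonZero ℓ₂}}
              → Map n → Set
IsIndexPair n ℓ₁ ℓ₂ f =
  Σ ℕ λ r₁ → Σ ℕ λ r₂ → (1 ≤ r₁) × (1 ≤ r₂) ×
  (Σ (Fin ℓ₁ → Fin ℓ₂ → Fin n) λ c →
     ∀ (a b : Fin n) →
       f a b ≡ (toℕ (c (toℕ a mod ℓ₁) (toℕ b mod ℓ₂)) + r₁ * toℕ a + r₂ * toℕ b) mod n)

agreements : (n : ℕ) .{{_ : NonZero n}} → Map n → ℕ
agreements n f =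
  length (filter (λ p → f (Data.Product.proj₁ p) (Data.Product.proj₂ p)
                          F.≟ DH n (Data.Product.proj₁ p) (Data.Product.proj₂ p))
                 (cartesianProduct (allFin n) (allFin n)))

-- Write x = γ^a and y = γ^b.  On a class of b modulo ℓ₂ the index-pair form turns f(x,y) = D(x,y)
-- into the linear congruence (a − r₂) b ≡ c + r₁ a (mod n), whose solutions b lie in one residue
-- class modulo n / gcd(a − r₂, n).  So for each a and each of the ℓ₂ classes at most gcd(a − r₂, n)
-- values of b agree, and there are at most ℓ₂ Σ_a gcd(a − r₂, n) ≤ ℓ₂ τ(n) n agreements in all.
-- The divisor bound τ(n)^K ≤ C_K n, obtained by comparing (k+1)^K with p^k prime power by prime
-- power (only primes p < 2^K can lose, each by a factor at most K^K), makes τ(n)^q ≤ n once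
-- n ≥ C_{2q}; this is the factor n^ε(n).

module Submission where

open import Defs
open import Data.Nat
open import Data.Nat.Properties
open import Data.Nat.Divisibility
open import Data.Nat.DivMod
open import Data.Nat.GCD using (gcd; gcd[m,n]∣m; gcd[m,n]∣n; gcd[m,n]≢0; n/gcd[m,n]≢0)
open import Data.Nat.Coprimality using (Coprime; coprime-divisor; coprime-/gcd)
import Data.Nat.Coprimality as Coprime
open import Data.Nat.Primality
open import Data.Nat.Induction using (<-rec)
open import Data.Nat.Tactic.RingSolver using (solve-∀)
open import Data.Fin using (Fin; toℕ)
import Data.Fin as F
open import Data.Fin.Properties using (toℕ-injective; toℕ<n; toℕ-fromℕ<)
open import Data.List using (List; []; _∷_; _++_; map; filter; upTo; length; cartesianProduct; allFin)
open import Data.List.Properties using (length-++; length-map; length-++-sucʳ; length-upTo)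
open import Data.List.Membership.Propositional using (_∈_)
open import Data.List.Membership.Propositional.Properties
open import Data.List.Relation.Unary.Any using (here; there)
import Data.List.Relation.Unary.All as All
open import Data.List.Relation.Unary.AllPairs using (_∷_)
open import Data.List.Relation.Unary.Unique.Propositional using (Unique)
import Data.List.Relation.Unary.Unique.Propositional.Properties as Unique
open import Data.Product using (Σ; _×_; _,_; proj₁; proj₂; ∃-syntax; ∃₂)
open import Data.Product.Properties using (,-injective)
open import Data.Sum using (inj₁; inj₂; [_,_]′)
open import Function using (id)
open import Relation.Nullary using (Dec; yes; no; contradiction)
open import Relation.Binary.PropositionalEquality

length-≤-injection : {A B : Set} (h : A → B) {xs : List A} (ys : List B) → Unique xs →
  (∀ {x} → x ∈ xs → h x ∈ ys) →
  (∀ {x y} → x ∈ xs → y ∈ xs → h x ≡ h y → x ≡ y) →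
  length xs ≤ length ys
length-≤-injection h {[]} ys _ _ _ = z≤n
length-≤-injection h {x ∷ xs} ys (x∉xs ∷ xs!) into inj with ∈-∃++ (into (here refl))
... | ys₁ , ys₂ , refl = begin
    suc (length xs)                    ≤⟨ s≤s (length-≤-injection h (ys₁ ++ ys₂) xs! into′ inj′) ⟩
    suc (length (ys₁ ++ ys₂))          ≡⟨ length-++-sucʳ ys₁ (h x) ys₂ ⟨
    length (ys₁ ++ h x ∷ ys₂)          ∎
  where
  open ≤-Reasoning
  inj′ : ∀ {y z} → y ∈ xs → z ∈ xs → h y ≡ h z → y ≡ z
  inj′ y∈ z∈ = inj (there y∈) (there z∈)
  into′ : ∀ {y} → y ∈ xs → h y ∈ ys₁ ++ ys₂
  into′ y∈ with ∈-++⁻ ys₁ (into (there y∈))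
  ... | inj₁ hy∈ys₁          = ∈-++⁺ˡ hy∈ys₁
  ... | inj₂ (here hy≡hx)    = contradiction (inj (there y∈) (here refl) hy≡hx)
                                             (λ y≡x → All.lookup x∉xs y∈ (sym y≡x))
  ... | inj₂ (there hy∈ys₂) = ∈-++⁺ʳ ys₁ hy∈ys₂

length-cartesianProduct : {A B : Set} (xs : List A) (ys : List B) →
  length (cartesianProduct xs ys) ≡ length xs * length ys
length-cartesianProduct []       ys = refl
length-cartesianProduct (x ∷ xs) ys = begin
  length (map (x ,_) ys ++ cartesianProduct xs ys)
    ≡⟨ length-++ (map (x ,_) ys) ⟩
  length (map (x ,_) ys) + length (cartesianProduct xs ys)
    ≡⟨ cong₂ _+_ (length-map (x ,_) ys) (length-cartesianProduct xs ys) ⟩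
  length ys + length xs * length ys
    ∎
  where open ≡-Reasoning

-- The divisor function

divisors : ℕ → List ℕ
divisors n = filter (_∣? n) (upTo (suc n))

τ : ℕ → ℕ
τ n = length (divisors n)

divisors-unique : ∀ n → Unique (divisors n)
divisors-unique n = Unique.filter⁺ (_∣? n) (Unique.upTo⁺ (suc n))

∈-divisors⁺ : ∀ {d n} .{{_ : NonZero n}} → d ∣ n → d ∈ divisors n
∈-divisors⁺ {n = n} d∣n = ∈-filter⁺ (_∣? n) (∈-upTo⁺ (s≤s (∣⇒≤ d∣n))) d∣n

∈-divisors⁻ : ∀ {d n} → d ∈ divisors n → d ∣ n
∈-divisors⁻ {n = n} d∈ = proj₂ (∈-filter⁻ (_∣? n) {xs = upTo (suc n)} d∈)

prime∤⇒coprime : ∀ {p d} → Prime p → p ∤ d → Coprime d p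
prime∤⇒coprime pp p∤d (i∣d , i∣p) with prime⇒irreducible pp i∣p
... | inj₁ i≡1 = i≡1
... | inj₂ refl = contradiction i∣d p∤d

coprime-∣-^* : ∀ {d p m} k → Coprime d p → d ∣ p ^ k * m → d ∣ m
coprime-∣-^* {d} {m = m} zero    _      d∣ = subst (d ∣_) (*-identityˡ m) d∣
coprime-∣-^* {d} {p} {m} (suc k) cop d∣ =
  coprime-∣-^* k cop (coprime-divisor cop (subst (d ∣_) (*-assoc p (p ^ k) m) d∣))

module _ {p} (prime-p : Prime p) where
  private instance
    p≢0 : NonZero p
    p≢0 = prime⇒nonZero prime-p

  τ[p^[1+k]*m]≤τ[m]+τ[p^k*m] : ∀ k m .{{_ : NonZero m}} → τ (p ^ suc k * m) ≤ τ m + τ (p ^ k * m)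
  τ[p^[1+k]*m]≤τ[m]+τ[p^k*m] k m = begin
    τ (p ^ suc k * m)
      ≤⟨ length-≤-injection id candidates (divisors-unique (p ^ suc k * m)) into (λ _ _ → id) ⟩
    length candidates                                  ≡⟨ length-++ (divisors m) ⟩
    τ m + length (map (p *_) (divisors (p ^ k * m)))   ≡⟨ cong (τ m +_) (length-map (p *_) (divisors (p ^ k * m))) ⟩
    τ m + τ (p ^ k * m)                                ∎
    where
    open ≤-Reasoning
    instance
      p^k*m≢0 : NonZero (p ^ k * m)
      p^k*m≢0 = m*n≢0 (p ^ k) m {{m^n≢0 p k}}
      p^[1+k]*m≢0 : NonZero (p ^ suc k * m)
      p^[1+k]*m≢0 = m*n≢0 (p ^ suc k) m {{m^n≢0 p (suc k)}}
    candidates : List ℕ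
    candidates = divisors m ++ map (p *_) (divisors (p ^ k * m))
    into : ∀ {d} → d ∈ divisors (p ^ suc k * m) → d ∈ candidates
    into {d} d∈ with p ∣? d
    ... | no p∤d = ∈-++⁺ˡ (∈-divisors⁺ (coprime-∣-^* (suc k) (prime∤⇒coprime prime-p p∤d) (∈-divisors⁻ d∈)))
    ... | yes (divides e refl) = ∈-++⁺ʳ (divisors m)
            (subst (_∈ map (p *_) (divisors (p ^ k * m))) (*-comm p e) (∈-map⁺ (p *_) (∈-divisors⁺ e∣p^k*m)))
      where
      e∣p^k*m : e ∣ p ^ k * m
      e∣p^k*m = *-cancelˡ-∣ p (subst₂ _∣_ (*-comm e p) (*-assoc p (p ^ k) m) (∈-divisors⁻ d∈))

  τ[p^k*m]≤[1+k]*τ[m] : ∀ k m .{{_ : NonZero m}} → τ (p ^ k * m) ≤ suc k * τ m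
  τ[p^k*m]≤[1+k]*τ[m] zero    m = ≤-reflexive (trans (cong τ (*-identityˡ m)) (sym (+-identityʳ (τ m))))
  τ[p^k*m]≤[1+k]*τ[m] (suc k) m =
    ≤-trans (τ[p^[1+k]*m]≤τ[m]+τ[p^k*m] k m) (+-monoʳ-≤ (τ m) (τ[p^k*m]≤[1+k]*τ[m] k m))

least-nontrivial-divisor : ∀ n .{{_ : NonTrivial n}} → ∃[ p ] 1 < p × p ∣ n × p Rough n
least-nontrivial-divisor n = search 2 (n ∸ 2) (m+[n∸m]≡n (nonTrivial⇒n>1 n)) (s≤s (s≤s z≤n)) 2-rough
  where
  search : ∀ m t → m + t ≡ n → 1 < m → m Rough n → ∃[ p ] 1 < p × p ∣ n × p Rough n
  search m t m+t≡n 1<m m-rough with m ∣? n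
  ... | yes m∣n = m , 1<m , m∣n , m-rough
  search m zero    m+t≡n 1<m m-rough | no m∤n =
    contradiction (subst (m ∣_) (trans (sym (+-identityʳ m)) m+t≡n) ∣-refl) m∤n
  search m (suc t) m+t≡n 1<m m-rough | no m∤n =
    search (suc m) t (trans (sym (+-suc m t)) m+t≡n) (m<n⇒m<1+n 1<m) (∤⇒rough-suc m∤n m-rough)

factor-out-power : ∀ {p} → 1 < p → ∀ n .{{_ : NonZero n}} → p ∣ n → ∃₂ λ k m → n ≡ p ^ suc k * m × p ∤ m
factor-out-power {p} 1<p = <-rec _ extract
  where
  Factorable : ℕ → Set
  Factorable n = .{{_ : NonZero n}} → p ∣ n → ∃₂ λ k m → n ≡ p ^ suc k * m × p ∤ m
  extract : ∀ n → (∀ {n′} → n′ < n → Factorable n′) → Factorable n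
  extract .(q * p) rec (divides-refl q) with p ∣? q
  ... | no p∤q = 0 , q , trans (*-comm q p) (cong (_* q) (sym (*-identityʳ p))) , p∤q
  ... | yes p∣q with rec (m<m*n q p 1<p) p∣q
    where instance _ = m*n≢0⇒m≢0 q
  ... | k , m , refl , p∤m = suc k , m , trans (*-comm _ p) (sym (*-assoc p (p ^ suc k) m)) , p∤m

^-distribʳ-* : ∀ m n k → (m * n) ^ k ≡ m ^ k * n ^ k
^-distribʳ-* m n zero    = refl
^-distribʳ-* m n (suc k) = trans (cong (m * n *_) (^-distribʳ-* m n k)) (interchange m n (m ^ k) (n ^ k))
  where
  interchange : ∀ a b c d → a * b * (c * d) ≡ a * c * (b * d)
  interchange = solve-∀

1+n≤2^n : ∀ n → suc n ≤ 2 ^ n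
1+n≤2^n zero    = s≤s z≤n
1+n≤2^n (suc n) = begin
  suc (suc n)      ≤⟨ +-mono-≤ (m^n>0 2 n) (1+n≤2^n n) ⟩
  2 ^ n + 2 ^ n    ≡⟨ cong (2 ^ n +_) (sym (+-identityʳ (2 ^ n))) ⟩
  2 ^ suc n        ∎
  where open ≤-Reasoning

[1+k]^K≤K^K*2^k : ∀ K k → suc k ^ K ≤ K ^ K * 2 ^ k
[1+k]^K≤K^K*2^k zero      k = ≤-trans (m^n>0 2 k) (≤-reflexive (sym (+-identityʳ (2 ^ k))))
[1+k]^K≤K^K*2^k K@(suc _) k = begin
  suc k ^ K                ≤⟨ ^-monoˡ-≤ K 1+k≤[1+k/K]*K ⟩
  (suc (k / K) * K) ^ K    ≡⟨ ^-distribʳ-* (suc (k / K)) K K ⟩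
  suc (k / K) ^ K * K ^ K  ≤⟨ *-monoˡ-≤ (K ^ K) (^-monoˡ-≤ K (1+n≤2^n (k / K))) ⟩
  (2 ^ (k / K)) ^ K * K ^ K ≡⟨ cong (_* K ^ K) (^-*-assoc 2 (k / K) K) ⟩
  2 ^ (k / K * K) * K ^ K  ≤⟨ *-monoˡ-≤ (K ^ K) (^-monoʳ-≤ 2 (m/n*n≤m k K)) ⟩
  2 ^ k * K ^ K            ≡⟨ *-comm (2 ^ k) (K ^ K) ⟩
  K ^ K * 2 ^ k            ∎
  where
  open ≤-Reasoning
  1+k≤[1+k/K]*K : suc k ≤ suc (k / K) * K
  1+k≤[1+k/K]*K = begin
    suc k                  ≡⟨ cong suc (m≡m%n+[m/n]*n k K) ⟩
    suc (k % K + k / K * K) ≤⟨ +-monoˡ-≤ (k / K * K) (m%n<n k K) ⟩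
    K + k / K * K          ∎

[1+k]^K≤p^k : ∀ K {p} → 2 ^ K ≤ p → ∀ k → suc k ^ K ≤ p ^ k
[1+k]^K≤p^k K {p} 2^K≤p k = begin
  suc k ^ K      ≤⟨ ^-monoˡ-≤ K (1+n≤2^n k) ⟩
  (2 ^ k) ^ K    ≡⟨ ^-*-assoc 2 k K ⟩
  2 ^ (k * K)    ≡⟨ cong (2 ^_) (*-comm k K) ⟩
  2 ^ (K * k)    ≡⟨ ^-*-assoc 2 K k ⟨
  (2 ^ K) ^ k    ≤⟨ ^-monoˡ-≤ k 2^K≤p ⟩
  p ^ k          ∎
  where open ≤-Reasoning

n^n≢0 : ∀ n → NonZero (n ^ n)
n^n≢0 zero    = _
n^n≢0 (suc n) = m^n≢0 (suc n) (suc n)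

module DivisorBound (K : ℕ) where

  X : ℕ
  X = K ^ K

  P : ℕ
  P = 2 ^ K

  C : ℕ
  C = X ^ P

  private instance
    X≢0 : NonZero X
    X≢0 = n^n≢0 K

  -- A prime power p^k in n contributes (k+1)^K to τ(n)^K; it is charged one factor X iff p < P.
  [1+k]^K*X^[P∸1+p]≤X^[P∸p]*p^k : ∀ {p} → 2 ≤ p → ∀ k → suc k ^ K * X ^ (P ∸ suc p) ≤ X ^ (P ∸ p) * p ^ k
  [1+k]^K*X^[P∸1+p]≤X^[P∸p]*p^k {p} 2≤p k with P ≤? p
  ... | yes P≤p = begin
      suc k ^ K * X ^ (P ∸ suc p) ≡⟨ cong (λ e → suc k ^ K * X ^ e) (m≤n⇒m∸n≡0 (m≤n⇒m≤1+n P≤p)) ⟩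
      suc k ^ K * 1               ≡⟨ *-identityʳ _ ⟩
      suc k ^ K                   ≤⟨ [1+k]^K≤p^k K P≤p k ⟩
      p ^ k                       ≡⟨ *-identityˡ (p ^ k) ⟨
      1 * p ^ k                   ≡⟨ cong (λ e → X ^ e * p ^ k) (m≤n⇒m∸n≡0 P≤p) ⟨
      X ^ (P ∸ p) * p ^ k         ∎
    where open ≤-Reasoning
  ... | no P≰p = begin
      suc k ^ K * X ^ (P ∸ suc p)  ≤⟨ *-monoˡ-≤ _ (≤-trans ([1+k]^K≤K^K*2^k K k) (*-monoʳ-≤ X (^-monoˡ-≤ k 2≤p))) ⟩
      X * p ^ k * X ^ (P ∸ suc p)  ≡⟨ swap X (p ^ k) (X ^ (P ∸ suc p)) ⟩
      X ^ suc (P ∸ suc p) * p ^ k  ≡⟨ cong (λ e → X ^ e * p ^ k) (+-∸-assoc 1 (≰⇒> P≰p)) ⟨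
      X ^ (P ∸ p) * p ^ k          ∎
    where
    open ≤-Reasoning
    swap : ∀ x a b → x * a * b ≡ x * b * a
    swap = solve-∀

  τ^K-prime-power-step : ∀ {p} → Prime p → ∀ k m .{{_ : NonZero m}} → τ m ^ K ≤ X ^ (P ∸ suc p) * m →
    τ (p ^ suc k * m) ^ K ≤ X ^ (P ∸ p) * (p ^ suc k * m)
  τ^K-prime-power-step {p} prime-p k m τ[m]^K≤ = begin
    τ (p ^ suc k * m) ^ K                      ≤⟨ ^-monoˡ-≤ K (τ[p^k*m]≤[1+k]*τ[m] prime-p (suc k) m) ⟩
    (suc (suc k) * τ m) ^ K                    ≡⟨ ^-distribʳ-* (suc (suc k)) (τ m) K ⟩
    suc (suc k) ^ K * τ m ^ K                  ≤⟨ *-monoʳ-≤ (suc (suc k) ^ K) τ[m]^K≤ ⟩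
    suc (suc k) ^ K * (X ^ (P ∸ suc p) * m)    ≡⟨ *-assoc (suc (suc k) ^ K) (X ^ (P ∸ suc p)) m ⟨
    suc (suc k) ^ K * X ^ (P ∸ suc p) * m      ≤⟨ *-monoˡ-≤ m ([1+k]^K*X^[P∸1+p]≤X^[P∸p]*p^k 2≤p (suc k)) ⟩
    X ^ (P ∸ p) * p ^ suc k * m                ≡⟨ *-assoc (X ^ (P ∸ p)) (p ^ suc k) m ⟩
    X ^ (P ∸ p) * (p ^ suc k * m)              ∎
    where
    open ≤-Reasoning
    2≤p : 2 ≤ p
    2≤p = nonTrivial⇒n>1 p {{prime⇒nonTrivial prime-p}}

  -- A j-rough n has no prime factor below j, so only the primes in [j, P) are charged.
  τ^K≤X^[P∸j]*n : ∀ n .{{_ : NonZero n}} j → j Rough n → τ n ^ K ≤ X ^ (P ∸ j) * n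
  τ^K≤X^[P∸j]*n = <-rec Bound bound
    where
    Bound : ℕ → Set
    Bound n = .{{_ : NonZero n}} → ∀ j → j Rough n → τ n ^ K ≤ X ^ (P ∸ j) * n
    bound : ∀ n → (∀ {m} → m < n → Bound m) → Bound n
    bound 1 _ j _ = begin
      τ 1 ^ K           ≡⟨ ^-zeroˡ K ⟩
      1                 ≤⟨ m^n>0 X (P ∸ j) ⟩
      X ^ (P ∸ j)       ≡⟨ *-identityʳ _ ⟨
      X ^ (P ∸ j) * 1   ∎
      where open ≤-Reasoning
    bound n@(2+ _) rec j j-rough with least-nontrivial-divisor n
    ... | p , 1<p , p∣n , p-rough with factor-out-power 1<p n p∣n
    ... | k , m , n≡p^[1+k]*m , p∤m = begin
      τ n ^ K                          ≡⟨ cong (λ x → τ x ^ K) n≡p^[1+k]*m ⟩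
      τ (p ^ suc k * m) ^ K            ≤⟨ τ^K-prime-power-step prime-p k m (rec m<n (suc p) m-rough) ⟩
      X ^ (P ∸ p) * (p ^ suc k * m)    ≡⟨ cong (X ^ (P ∸ p) *_) n≡p^[1+k]*m ⟨
      X ^ (P ∸ p) * n                  ≤⟨ *-monoˡ-≤ n (^-monoʳ-≤ X (∸-monoʳ-≤ P j≤p)) ⟩
      X ^ (P ∸ j) * n                  ∎
      where
      open ≤-Reasoning
      instance
        p-nonTrivial : NonTrivial p
        p-nonTrivial = n>1⇒nonTrivial 1<p
        m≢0 : NonZero m
        m≢0 = m*n≢0⇒n≢0 (p ^ suc k) {{subst NonZero n≡p^[1+k]*m nonZero}}
      prime-p : Prime p
      prime-p = rough∧∣⇒prime p-rough p∣n
      j≤p : j ≤ p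
      j≤p = rough⇒≤ (rough∧∣⇒rough j-rough p∣n)
      m<n : m < n
      m<n = begin-strict
        m                   <⟨ m<m*n m (p ^ suc k) (^-monoʳ-< p 1<p {0} {suc k} z<s) ⟩
        m * p ^ suc k       ≡⟨ *-comm m (p ^ suc k) ⟩
        p ^ suc k * m       ≡⟨ n≡p^[1+k]*m ⟨
        n                   ∎
      m-rough : suc p Rough m
      m-rough = ∤⇒rough-suc p∤m (rough∧∣⇒rough p-rough (subst (m ∣_) (sym n≡p^[1+k]*m) (n∣m*n (p ^ suc k))))

  τ^K≤C*n : ∀ n .{{_ : NonZero n}} → τ n ^ K ≤ C * n
  τ^K≤C*n n = τ^K≤X^[P∸j]*n n 0 0-rough

τ^q≤n : ∀ q n .{{_ : NonZero n}} → DivisorBound.C (q + q) ≤ n → τ n ^ q ≤ n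
τ^q≤n q n C≤n with τ n ^ q ≤? n
... | yes τ^q≤n = τ^q≤n
... | no τ^q≰n = contradiction n*n<n*n (n≮n (n * n))
  where
  open ≤-Reasoning
  n*n<n*n : n * n < n * n
  n*n<n*n = begin-strict
    n * n              <⟨ *-mono-< (≰⇒> τ^q≰n) (≰⇒> τ^q≰n) ⟩
    τ n ^ q * τ n ^ q  ≡⟨ ^-distribˡ-+-* (τ n) q q ⟨
    τ n ^ (q + q)      ≤⟨ DivisorBound.τ^K≤C*n (q + q) n ⟩
    DivisorBound.C (q + q) * n ≤⟨ *-monoˡ-≤ n C≤n ⟩
    n * n              ∎

-- Congruences modulo n

module Congruence (n : ℕ) .{{_ : NonZero n}} where

  infix 4 _≈_
  _≈_ : ℕ → ℕ → Set
  a ≈ b = a % n ≡ b % n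

  %-≈ : ∀ a → a % n ≈ a
  %-≈ a = m%n%n≡m%n a n

  +-cong-≈ : ∀ {a a′ b b′} → a ≈ a′ → b ≈ b′ → a + b ≈ a′ + b′
  +-cong-≈ {a} {a′} {b} {b′} a≡a′ b≡b′ = begin
    (a + b) % n              ≡⟨ %-distribˡ-+ a b n ⟩
    (a % n + b % n) % n      ≡⟨ cong₂ (λ u v → (u + v) % n) a≡a′ b≡b′ ⟩
    (a′ % n + b′ % n) % n    ≡⟨ %-distribˡ-+ a′ b′ n ⟨
    (a′ + b′) % n            ∎
    where open ≡-Reasoning

  *-cong-≈ : ∀ {a a′ b b′} → a ≈ a′ → b ≈ b′ → a * b ≈ a′ * b′
  *-cong-≈ {a} {a′} {b} {b′} a≡a′ b≡b′ = begin
    (a * b) % n              ≡⟨ %-distribˡ-* a b n ⟩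
    (a % n * (b % n)) % n    ≡⟨ cong₂ (λ u v → (u * v) % n) a≡a′ b≡b′ ⟩
    (a′ % n * (b′ % n)) % n  ≡⟨ %-distribˡ-* a′ b′ n ⟨
    (a′ * b′) % n            ∎
    where open ≡-Reasoning

  +-inverse-≈ : ∀ r → r + (n ∸ r % n) ≈ 0
  +-inverse-≈ r = begin
    (r + (n ∸ r % n)) % n         ≡⟨ +-cong-≈ (sym (%-≈ r)) refl ⟩
    (r % n + (n ∸ r % n)) % n     ≡⟨ cong (_% n) (m+[n∸m]≡n (m%n≤n r n)) ⟩
    n % n                         ≡⟨ n%n≡0 n ⟩
    0                             ≡⟨ m<n⇒m%n≡m (>-nonZero⁻¹ n) ⟨
    0 % n                         ∎
    where open ≡-Reasoning

  +-cancelʳ-≈ : ∀ {a b} c → a + c ≈ b + c → a ≈ b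
  +-cancelʳ-≈ {a} {b} c a+c≡b+c = begin
    a % n                      ≡⟨ cong (_% n) (+-identityʳ a) ⟨
    (a + 0) % n                ≡⟨ +-cong-≈ {a} refl (+-inverse-≈ c) ⟨
    (a + (c + c⁻)) % n         ≡⟨ cong (_% n) (+-assoc a c c⁻) ⟨
    (a + c + c⁻) % n           ≡⟨ +-cong-≈ a+c≡b+c refl ⟩
    (b + c + c⁻) % n           ≡⟨ cong (_% n) (+-assoc b c c⁻) ⟩
    (b + (c + c⁻)) % n         ≡⟨ +-cong-≈ {b} refl (+-inverse-≈ c) ⟩
    (b + 0) % n                ≡⟨ cong (_% n) (+-identityʳ b) ⟩
    b % n                      ∎
    where
    open ≡-Reasoning
    c⁻ = n ∸ c % n

  ≈⇒∣∸ : ∀ {a b} → b ≤ a → a ≈ b → n ∣ a ∸ b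
  ≈⇒∣∸ {a} {b} b≤a a≡b = m%n≡0⇒n∣m (a ∸ b) n (begin
    (a ∸ b) % n          ≡⟨ +-cancelʳ-≈ b (subst (λ c → c ≈ 0 + b) (sym (m∸n+n≡m b≤a)) a≡b) ⟩
    0 % n                ≡⟨ m<n⇒m%n≡m (>-nonZero⁻¹ n) ⟩
    0                    ∎)
    where open ≡-Reasoning

*-cancelˡ-%-gcd : ∀ {n} .{{_ : NonZero n}} x {b b′} →
  .{{_ : NonZero (gcd x n)}} .{{_ : NonZero (n / gcd x n)}} →
  (x * b) % n ≡ (x * b′) % n → b % (n / gcd x n) ≡ b′ % (n / gcd x n)
*-cancelˡ-%-gcd {n} x {b} {b′} x*b≈x*b′ =
  [ (λ b≤b′ → sym (cancel b≤b′ (sym x*b≈x*b′))) , (λ b′≤b → cancel b′≤b x*b≈x*b′) ]′ (≤-total b b′)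
  where
  open Congruence n
  g = gcd x n
  M = n / gcd x n
  cancel : ∀ {b b′} → b ≤ b′ → x * b′ ≈ x * b → b′ % M ≡ b % M
  cancel {b} {b′} b≤b′ x*b′≈x*b = begin
    b′ % M              ≡⟨ cong (_% M) (m+[n∸m]≡n b≤b′) ⟨
    (b + (b′ ∸ b)) % M  ≡⟨ %-remove-+ʳ b M∣b′∸b ⟩
    b % M               ∎
    where
    open ≡-Reasoning
    d = b′ ∸ b
    u = x / g
    x*d≡g*[u*d] : x * d ≡ g * (u * d)
    x*d≡g*[u*d] = trans (cong (_* d) (sym (m*[n/m]≡n (gcd[m,n]∣m x n)))) (*-assoc g u d)
    n∣x*d : n ∣ x * d
    n∣x*d = subst (n ∣_) (sym (*-distribˡ-∸ x b′ b)) (≈⇒∣∸ (*-monoʳ-≤ x b≤b′) x*b′≈x*b)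
    M∣u*d : M ∣ u * d
    M∣u*d = *-cancelˡ-∣ g (subst₂ _∣_ (sym (m*[n/m]≡n (gcd[m,n]∣n x n))) x*d≡g*[u*d] n∣x*d)
    M∣b′∸b : M ∣ d
    M∣b′∸b = coprime-divisor (Coprime.sym (coprime-/gcd x n)) M∣u*d

%-/-injective : ∀ {a b} d .{{_ : NonZero d}} → a % d ≡ b % d → a / d ≡ b / d → a ≡ b
%-/-injective {a} {b} d a%d≡b%d a/d≡b/d = begin
  a                   ≡⟨ m≡m%n+[m/n]*n a d ⟩
  a % d + a / d * d   ≡⟨ cong₂ (λ r q → r + q * d) a%d≡b%d a/d≡b/d ⟩
  b % d + b / d * d   ≡⟨ m≡m%n+[m/n]*n b d ⟨
  b                   ∎
  where open ≡-Reasoning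

∣∧<⇒+-injective : ∀ {d a a′ t t′} .{{_ : NonZero d}} → d ∣ a → d ∣ a′ → t < d → t′ < d →
  a + t ≡ a′ + t′ → a ≡ a′ × t ≡ t′
∣∧<⇒+-injective {d} {a} {a′} {t} {t′} d∣a d∣a′ t<d t′<d a+t≡a′+t′ =
  +-cancelʳ-≡ t′ a a′ (subst (λ s → a + s ≡ a′ + t′) t≡t′ a+t≡a′+t′) , t≡t′
  where
  open ≡-Reasoning
  t≡t′ : t ≡ t′
  t≡t′ = begin
    t               ≡⟨ m<n⇒m%n≡m t<d ⟨
    t % d           ≡⟨ %-remove-+ˡ t d∣a ⟨
    (a + t) % d     ≡⟨ cong (_% d) a+t≡a′+t′ ⟩
    (a′ + t′) % d   ≡⟨ %-remove-+ˡ t′ d∣a′ ⟩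
    t′ % d          ≡⟨ m<n⇒m%n≡m t′<d ⟩
    t′              ∎

∣∧<⇒+< : ∀ {d a n t} → d ∣ a → d ∣ n → a < n → t < d → a + t < n
∣∧<⇒+< {d} {a} {n} {t} d∣a d∣n a<n t<d = begin-strict
  a + t         <⟨ +-monoʳ-< a t<d ⟩
  a + d         ≤⟨ +-monoʳ-≤ a (∣⇒≤ {{>-nonZero (m<n⇒0<n∸m a<n)}} d∣n∸a) ⟩
  a + (n ∸ a)   ≡⟨ m+[n∸m]≡n (<⇒≤ a<n) ⟩
  n             ∎
  where
  open ≤-Reasoning
  d∣n∸a : d ∣ n ∸ a
  d∣n∸a = ∣m+n∣m⇒∣n (subst (d ∣_) (sym (m+[n∸m]≡n (<⇒≤ a<n))) d∣n) d∣a

-- Counting agreements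

module AgreementCount
  (n ℓ r : ℕ) .{{_ : NonZero n}} .{{_ : NonZero ℓ}}
  (K : Fin n → Fin n → ℕ)
  (K-resp : ∀ a {b b′} → toℕ b % ℓ ≡ toℕ b′ % ℓ → K a b ≡ K a b′)
  {Agree : Fin n × Fin n → Set} (agree? : ∀ ab → Dec (Agree ab))
  (agree⇒≈ : ∀ {a b} → Agree (a , b) → (K a b + r * toℕ b) % n ≡ (toℕ a * toℕ b) % n)
  where

  open Congruence n

  r⁻ : ℕ
  r⁻ = n ∸ r % n

  -- a − r modulo n
  x : Fin n → ℕ
  x a = (toℕ a + r⁻) % n

  g : Fin n → ℕ
  g a = gcd (x a) n

  instance
    g≢0 : ∀ {a} → NonZero (g a)
    g≢0 {a} = ≢-nonZero (gcd[m,n]≢0 (x a) n (inj₂ (≢-nonZero⁻¹ n)))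

  M : Fin n → ℕ
  M a = n / g a

  instance
    M≢0 : ∀ {a} → NonZero (M a)
    M≢0 {a} = ≢-nonZero (n/gcd[m,n]≢0 (x a) n)

  -- Agreeing b of one class modulo ℓ are congruent modulo M a, so b is fixed by its block
  -- index b / M a < g a; as g a ∣ x a, the sum x a + b / M a < n still determines x a, hence a.
  code : Fin n × Fin n → ℕ × ℕ × ℕ
  code (a , b) = toℕ b % ℓ , g a , x a + toℕ b / M a

  x+r≈a : ∀ a → x a + r ≈ toℕ a
  x+r≈a a = begin
    (x a + r) % n              ≡⟨ +-cong-≈ (%-≈ (toℕ a + r⁻)) refl ⟩
    (toℕ a + r⁻ + r) % n       ≡⟨ cong (_% n) (trans (+-assoc (toℕ a) r⁻ r) (cong (toℕ a +_) (+-comm r⁻ r))) ⟩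
    (toℕ a + (r + r⁻)) % n     ≡⟨ +-cong-≈ {toℕ a} refl (+-inverse-≈ r) ⟩
    (toℕ a + 0) % n            ≡⟨ cong (_% n) (+-identityʳ (toℕ a)) ⟩
    toℕ a % n                  ∎
    where open ≡-Reasoning

  x*b≈K : ∀ {a b} → Agree (a , b) → x a * toℕ b ≈ K a b
  x*b≈K {a} {b} agree = +-cancelʳ-≈ (r * toℕ b) (begin
    (x a * toℕ b + r * toℕ b) % n   ≡⟨ cong (_% n) (*-distribʳ-+ (toℕ b) (x a) r) ⟨
    ((x a + r) * toℕ b) % n         ≡⟨ *-cong-≈ (x+r≈a a) refl ⟩
    (toℕ a * toℕ b) % n             ≡⟨ agree⇒≈ agree ⟨
    (K a b + r * toℕ b) % n         ∎)
    where open ≡-Reasoning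

  x-injective : ∀ {a a′} → x a ≡ x a′ → a ≡ a′
  x-injective {a} {a′} xa≡xa′ = toℕ-injective (begin
    toℕ a          ≡⟨ m<n⇒m%n≡m (toℕ<n a) ⟨
    toℕ a % n      ≡⟨ +-cancelʳ-≈ r⁻ xa≡xa′ ⟩
    toℕ a′ % n     ≡⟨ m<n⇒m%n≡m (toℕ<n a′) ⟩
    toℕ a′         ∎)
    where open ≡-Reasoning

  same-class⇒≡-mod-M : ∀ {a b b′} → Agree (a , b) → Agree (a , b′) → toℕ b % ℓ ≡ toℕ b′ % ℓ →
    toℕ b % M a ≡ toℕ b′ % M a
  same-class⇒≡-mod-M {a} {b} {b′} agree agree′ b%ℓ≡b′%ℓ = *-cancelˡ-%-gcd (x a) (begin
    (x a * toℕ b) % n     ≡⟨ x*b≈K agree ⟩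
    K a b % n             ≡⟨ cong (_% n) (K-resp a b%ℓ≡b′%ℓ) ⟩
    K a b′ % n            ≡⟨ x*b≈K agree′ ⟨
    (x a * toℕ b′) % n    ∎)
    where open ≡-Reasoning

  g∣x : ∀ a → g a ∣ x a
  g∣x a = gcd[m,n]∣m (x a) n

  g∣n : ∀ a → g a ∣ n
  g∣n a = gcd[m,n]∣n (x a) n

  b/M<g : ∀ a b → toℕ b / M a < g a
  b/M<g a b = m<n*o⇒m/o<n (subst (toℕ b <_) (sym (m*[n/m]≡n (g∣n a))) (toℕ<n b))

  code-injective : ∀ {a b a′ b′} → Agree (a , b) → Agree (a′ , b′) → code (a , b) ≡ code (a′ , b′) →
    (a , b) ≡ (a′ , b′)
  code-injective {a} {b} {a′} {b′} agree agree′ code≡ with ,-injective code≡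
  ... | b%ℓ≡b′%ℓ , rest with ,-injective rest
  ... | ga≡ga′ , offset≡
    with ∣∧<⇒+-injective (g∣x a) (subst (_∣ x a′) (sym ga≡ga′) (g∣x a′))
           (b/M<g a b) (subst (_ <_) (sym ga≡ga′) (b/M<g a′ b′)) offset≡
  ... | xa≡xa′ , block≡ with x-injective xa≡xa′
  ... | refl = cong (a ,_) (toℕ-injective (%-/-injective (M a) (same-class⇒≡-mod-M agree agree′ b%ℓ≡b′%ℓ) block≡))

  Codes : List (ℕ × ℕ × ℕ)
  Codes = cartesianProduct (upTo ℓ) (cartesianProduct (divisors n) (upTo n))

  code∈Codes : ∀ ab → code ab ∈ Codes
  code∈Codes (a , b) = ∈-cartesianProduct⁺ (∈-upTo⁺ (m%n<n (toℕ b) ℓ))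
    (∈-cartesianProduct⁺ (∈-divisors⁺ (g∣n a)) (∈-upTo⁺ (∣∧<⇒+< (g∣x a) (g∣n a) (m%n<n _ n) (b/M<g a b))))

  count≤ℓ*τ[n]*n : length (filter agree? (cartesianProduct (allFin n) (allFin n))) ≤ ℓ * (τ n * n)
  count≤ℓ*τ[n]*n = begin
    length agreeing   ≤⟨ length-≤-injection code Codes agreeing-unique (λ {ab} _ → code∈Codes ab) injective ⟩
    length Codes      ≡⟨ length-cartesianProduct (upTo ℓ) _ ⟩
    length (upTo ℓ) * length (cartesianProduct (divisors n) (upTo n))
                      ≡⟨ cong₂ _*_ (length-upTo ℓ) (length-cartesianProduct (divisors n) (upTo n)) ⟩
    ℓ * (τ n * length (upTo n))
                      ≡⟨ cong (λ k → ℓ * (τ n * k)) (length-upTo n) ⟩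
    ℓ * (τ n * n)     ∎
    where
    open ≤-Reasoning
    pairs = cartesianProduct (allFin n) (allFin n)
    agreeing = filter agree? pairs
    agreeing-unique = Unique.filter⁺ agree? (Unique.cartesianProduct⁺ (Unique.allFin⁺ n) (Unique.allFin⁺ n))
    agrees : ∀ {ab} → ab ∈ agreeing → Agree ab
    agrees ab∈ = proj₂ (∈-filter⁻ agree? {xs = pairs} ab∈)
    injective : ∀ {ab ab′} → ab ∈ agreeing → ab′ ∈ agreeing → code ab ≡ code ab′ → ab ≡ ab′
    injective {_ , _} {_ , _} ab∈ ab′∈ = code-injective (agrees ab∈) (agrees ab′∈)

toℕ-mod : ∀ m n .{{_ : NonZero n}} → toℕ (m mod n) ≡ m % n
toℕ-mod m n = toℕ-fromℕ< (m%n<n m n)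

mod-cong : ∀ {m m′ n} .{{_ : NonZero n}} → m % n ≡ m′ % n → m mod n ≡ m′ mod n
mod-cong {m} {m′} {n} m%n≡m′%n = toℕ-injective (trans (toℕ-mod m n) (trans m%n≡m′%n (sym (toℕ-mod m′ n))))

agreements≤ℓ₂*τ[n]*n : ∀ n ℓ₁ ℓ₂ .{{_ : NonZero n}} .{{_ : NonZero ℓ₁}} .{{_ : NonZero ℓ₂}} (f : Map n) →
  IsIndexPair n ℓ₁ ℓ₂ f → agreements n f ≤ ℓ₂ * (τ n * n)
agreements≤ℓ₂*τ[n]*n n ℓ₁ ℓ₂ f (r₁ , r₂ , _ , _ , c , f≡) =
  AgreementCount.count≤ℓ*τ[n]*n n ℓ₂ r₂ K K-resp
    (λ ab → f (proj₁ ab) (proj₂ ab) F.≟ DH n (proj₁ ab) (proj₂ ab)) agree⇒≈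
  where
  K : Fin n → Fin n → ℕ
  K a b = toℕ (c (toℕ a mod ℓ₁) (toℕ b mod ℓ₂)) + r₁ * toℕ a
  K-resp : ∀ a {b b′} → toℕ b % ℓ₂ ≡ toℕ b′ % ℓ₂ → K a b ≡ K a b′
  K-resp a b%ℓ₂≡b′%ℓ₂ = cong (λ κ → toℕ (c (toℕ a mod ℓ₁) κ) + r₁ * toℕ a) (mod-cong b%ℓ₂≡b′%ℓ₂)
  agree⇒≈ : ∀ {a b} → f a b ≡ DH n a b → (K a b + r₂ * toℕ b) % n ≡ (toℕ a * toℕ b) % n
  agree⇒≈ {a} {b} f≡DH = begin
    (K a b + r₂ * toℕ b) % n              ≡⟨ toℕ-mod (K a b + r₂ * toℕ b) n ⟨
    toℕ ((K a b + r₂ * toℕ b) mod n)      ≡⟨ cong toℕ (trans (sym (f≡ a b)) f≡DH) ⟩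
    toℕ ((toℕ a * toℕ b) mod n)           ≡⟨ toℕ-mod (toℕ a * toℕ b) n ⟩
    (toℕ a * toℕ b) % n                   ∎
    where open ≡-Reasoning

theorem4 : (p q : ℕ) → 1 ≤ p → 1 ≤ q →
    Σ ℕ λ N → (n : ℕ) → .{{_ : NonZero n}} → N ≤ n →
      (ℓ₁ ℓ₂ : ℕ) → .{{_ : NonZero ℓ₁}} → .{{_ : NonZero ℓ₂}} → ℓ₁ ∣ n → ℓ₂ ∣ n →
      (f : Map n) → IsIndexPair n ℓ₁ ℓ₂ f →
      agreements n f ^ q ≤ (ℓ₁ * ℓ₂ * n) ^ q * n ^ p
theorem4 (suc p′) q _ _ = DivisorBound.C (q + q) , λ n C≤n ℓ₁ ℓ₂ _ _ f f-index → begin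
  agreements n f ^ q          ≤⟨ ^-monoˡ-≤ q (agreements≤ℓ₂*τ[n]*n n ℓ₁ ℓ₂ f f-index) ⟩
  (ℓ₂ * (τ n * n)) ^ q        ≡⟨ cong (_^ q) (rearrange ℓ₂ (τ n) n) ⟩
  (ℓ₂ * n * τ n) ^ q          ≡⟨ ^-distribʳ-* (ℓ₂ * n) (τ n) q ⟩
  (ℓ₂ * n) ^ q * τ n ^ q      ≤⟨ *-mono-≤ (^-monoˡ-≤ q (ℓ₂*n≤ℓ₁*ℓ₂*n ℓ₁ ℓ₂ n))
                                           (≤-trans (τ^q≤n q n C≤n) (n≤n^[1+p] n)) ⟩
  (ℓ₁ * ℓ₂ * n) ^ q * n ^ suc p′ ∎
  where
  open ≤-Reasoning
  rearrange : ∀ a b c → a * (b * c) ≡ a * c * b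
  rearrange a b c = trans (cong (a *_) (*-comm b c)) (sym (*-assoc a c b))
  ℓ₂*n≤ℓ₁*ℓ₂*n : ∀ ℓ₁ ℓ₂ n .{{_ : NonZero ℓ₁}} → ℓ₂ * n ≤ ℓ₁ * ℓ₂ * n
  ℓ₂*n≤ℓ₁*ℓ₂*n ℓ₁ ℓ₂ n = ≤-trans (m≤n*m (ℓ₂ * n) ℓ₁) (≤-reflexive (sym (*-assoc ℓ₁ ℓ₂ n)))
  n≤n^[1+p] : ∀ n .{{_ : NonZero n}} → n ≤ n ^ suc p′
  n≤n^[1+p] n = m≤m*n n (n ^ p′) {{m^n≢0 n p′}}
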